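{- Let $\vdash_\mathsf{O}$ be the smallest intro-elim logic $\vdash$ such that $\neg\neg\varphi\vdash\varphi$ for all $\varphi\in\mathcal{L}$. Define the translation $g:\mathcal{L}\to\mathcal{L}$ by $g(p)=\neg\neg p$, $g(\neg\varphi)=\neg g(\varphi)$, $g(\varphi\wedge\psi)=(g(\varphi)\wedge g(\psi))$, and $g(\varphi\vee\psi)=g(\neg(\neg\varphi\wedge\neg\psi))$. Then for all $\varphi,\psi\in\mathcal{L}$, $\varphi\vdash_\mathsf{O}\psi$ if and only if $g(\varphi)\vdash_\mathsf{F} g(\psi)$.
   Context: Let $\mathsf{Prop}$ be a nonempty set of propositional variables and $\mathcal{L}$ the set of formulas given by $\varphi::= p\mid\neg\varphi\mid(\varphi\wedge\varphi)\mid(\varphi\vee\varphi)$ with $p\in\mathsf{Prop}$. An intro-elim logic is a binary relation $\vdash\,\subseteq\mathcal{L}\times\mathcal{L}$ such that for all $\varphi,\psi,\chi$: (1) $\varphi\vdash\varphi$; (2) $\varphi\wedge\psi\vdash\varphi$; (3) $\varphi\wedge\psi\vdash\psi$; (4) $\varphi\vdash\varphi\vee\psi$; (5) $\varphi\vdash\psi\vee\varphi$; (6) $\varphi\vdash\neg\neg\varphi$; (7) $\varphi\wedge\neg\varphi\vdash\psi$; (8) if $\varphi\vdash\psi$ and $\psi\vdash\chi$ then $\varphi\vdash\chi$; (9) if $\varphi\vdash\psi$ and $\varphi\vdash\chi$ then $\varphi\vdash\psi\wedge\chi$; (10) if $\varphi\vdash\chi$ and $\psi\vdash\chi$ then $\varphi\vee\psi\vdash\chi$;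 (11) if $\varphi\vdash\psi$ then $\neg\psi\vdash\neg\varphi$. The relation $\vdash_\mathsf{F}$ is defined by Fitch-style proofs. Proofs are finite sequences whose first entry is a formula and whose later entries are formulas or proofs. The set of proofs is the smallest set containing $\langle\varphi\rangle$ for every formula $\varphi$ and closed under the following, where $\langle\sigma_1,\dots,\sigma_n\rangle$ is a proof and $1\le i,j\le n$: (i) if $\tau$ is a proof, then $\langle\sigma_1,\dots,\sigma_n,\tau\rangle$ is a proof; ($\wedge$I) if $\sigma_i,\sigma_j$ are formulas, $\langle\sigma_1,\dots,\sigma_n,\sigma_i\wedge\sigma_j\rangle$ is a proof; ($\wedge$E) if $\sigma_i$ is $\varphi\wedge\psi$, then $\langle\sigma_1,\dots,\sigma_n,\varphi\rangle$ and $\langle\sigma_1,\dots,\sigma_n,\psi\rangle$ are proofs; ($\vee$I) if $\sigma_i$ is a formula, then for any formula $\varphi$, $\langle\sigma_1,\dots,\sigma_n,\sigma_i\vee\varphi\rangle$ and $\langle\sigma_1,\dots,\sigma_n,\varphi\vee\sigma_i\rangle$ are proofs; ($\vee$E) if $\sigma_i$ is $\varphi\vee\psi$, $\sigma_{n-1}$ is a sequence beginning with $\varphi$ and ending with $\chi$, and $\sigma_n$ is a sequence beginning with $\psi$ and ending with $\chi$, then $\langle\sigma_1,\dots,\sigma_n,\chi\rangle$ is a proof; ($\neg$I) if $\sigma_i$ is a formula $\psi$ and $\sigma_n$ is a sequence beginning with $\varphi$ and ending with $\neg\psi$, then $\langle\sigma_1,\dots,\sigma_n,\neg\varphi\rangle$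 is a proof; ($\neg$E) if $\sigma_i$ is $\varphi$ and $\sigma_j$ is $\neg\varphi$, then for any formula $\psi$, $\langle\sigma_1,\dots,\sigma_n,\psi\rangle$ is a proof. Then $\varphi\vdash_\mathsf{F}\psi$ iff there is a proof whose first entry is $\varphi$ and whose last entry is $\psi$. -}

module Defs where

open import Data.Product using (Σ; _×_)
open import Relation.Binary.PropositionalEquality using (_≡_)

data Fm (A : Set) : Set where
  var : A → Fm A
  ¬_  : Fm A → Fm A
  _∧_ : Fm A → Fm A → Fm A
  _∨_ : Fm A → Fm A → Fm A

infix  9 ¬_
infixl 7 _∧_
infixl 6 _∨_

module _ {A : Set} where

  data _⊢O_ : Fm A → Fm A → Set where
    refl⊢  : ∀ {φ} → φ ⊢O φ
    ∧E₁    : ∀ {φ ψ} → (φ ∧ ψ) ⊢O φ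
    ∧E₂    : ∀ {φ ψ} → (φ ∧ ψ) ⊢O ψ
    ∨I₁    : ∀ {φ ψ} → φ ⊢O (φ ∨ ψ)
    ∨I₂    : ∀ {φ ψ} → φ ⊢O (ψ ∨ φ)
    ¬¬I    : ∀ {φ} → φ ⊢O ¬ ¬ φ
    expl   : ∀ {φ ψ} → (φ ∧ ¬ φ) ⊢O ψ
    trans⊢ : ∀ {φ ψ χ} → φ ⊢O ψ → ψ ⊢O χ → φ ⊢O χ
    ∧I     : ∀ {φ ψ χ} → φ ⊢O ψ → φ ⊢O χ → φ ⊢O (ψ ∧ χ)
    ∨E     : ∀ {φ ψ χ} → φ ⊢O χ → ψ ⊢O χ → (φ ∨ ψ) ⊢O χ
    contra : ∀ {φ ψ} → φ ⊢O ψ → ¬ ψ ⊢O ¬ φ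
    ¬¬E    : ∀ {φ} → ¬ ¬ φ ⊢O φ

  -- The translation g.  The clause g(φ∨ψ) = g(¬(¬φ∧¬ψ)) is written in
  -- its (definitionally unfolded) form ¬(¬gφ ∧ ¬gψ) to make recursion structural.
  g : Fm A → Fm A
  g (var p) = ¬ ¬ var p
  g (¬ φ)   = ¬ g φ
  g (φ ∧ ψ) = g φ ∧ g ψ
  g (φ ∨ ψ) = ¬ (¬ g φ ∧ ¬ g ψ)

  -- Fitch-style proofs.  A sequence is a nonempty finite sequence whose
  -- first entry is a formula and whose later entries are formulas or
  -- sequences; represented in snoc form.
  mutual
    data Seq : Set where
      start : Fm A → Seq
      _▷_   : Seq → Entry → Seq

    data Entry : Set where
      fm  : Fm A → Entry
      sub : Seq → Entry

  infixl 5 _▷_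

  first : Seq → Fm A
  first (start φ) = φ
  first (s ▷ _)   = first s

  last : Seq → Entry
  last (start φ) = fm φ
  last (s ▷ e)   = e

  data _∋_ : Seq → Fm A → Set where
    here₀ : ∀ {φ} → start φ ∋ φ
    here  : ∀ {s φ} → (s ▷ fm φ) ∋ φ
    there : ∀ {s e φ} → s ∋ φ → (s ▷ e) ∋ φ

  infix 4 _∋_

  BeginsEnds : Seq → Fm A → Fm A → Set
  BeginsEnds τ φ χ = (first τ ≡ φ) × (last τ ≡ fm χ)

  data IsProof : Seq → Set where
    p-start : ∀ {φ} → IsProof (start φ)
    p-sub   : ∀ {s τ} → IsProof s → IsProof τ → IsProof (s ▷ sub τ)
    p-∧I    : ∀ {s φ ψ} → IsProof s → s ∋ φ → s ∋ ψ → IsProof (s ▷ fm (φ ∧ ψ))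
    p-∧E₁   : ∀ {s φ ψ} → IsProof s → s ∋ (φ ∧ ψ) → IsProof (s ▷ fm φ)
    p-∧E₂   : ∀ {s φ ψ} → IsProof s → s ∋ (φ ∧ ψ) → IsProof (s ▷ fm ψ)
    p-∨I₁   : ∀ {s φ ψ} → IsProof s → s ∋ φ → IsProof (s ▷ fm (φ ∨ ψ))
    p-∨I₂   : ∀ {s φ ψ} → IsProof s → s ∋ φ → IsProof (s ▷ fm (ψ ∨ φ))
    p-∨E    : ∀ {s τ₁ τ₂ φ ψ χ} → IsProof (s ▷ sub τ₁ ▷ sub τ₂) →
              (s ▷ sub τ₁ ▷ sub τ₂) ∋ (φ ∨ ψ) →
              BeginsEnds τ₁ φ χ → BeginsEnds τ₂ ψ χ →
              IsProof (s ▷ sub τ₁ ▷ sub τ₂ ▷ fm χ)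
    p-¬I    : ∀ {s τ φ ψ} → IsProof (s ▷ sub τ) → (s ▷ sub τ) ∋ ψ →
              BeginsEnds τ φ (¬ ψ) →
              IsProof (s ▷ sub τ ▷ fm (¬ φ))
    p-¬E    : ∀ {s φ ψ} → IsProof s → s ∋ φ → s ∋ (¬ φ) → IsProof (s ▷ fm ψ)

  _⊢F_ : Fm A → Fm A → Set
  φ ⊢F ψ = Σ Seq (λ s → IsProof s × BeginsEnds s φ ψ)

  infix 3 _⊢O_ _⊢F_

-- Every Fitch rule is an intro-elim rule, so ⊢F ⊆ ⊢O; and ⊢O, being classical,
-- proves φ and g φ equivalent.  Hence g φ ⊢F g ψ gives φ ⊢O ψ.  Conversely
-- g maps each rule of ⊢O to a derived rule of ⊢F.  The two rules that are not
-- intuitionistically valid, ¬¬E and ∨E (whose conclusion is only reached under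
-- a double negation, since g turns ∨ into ¬(¬_ ∧ ¬_)), survive because every
-- formula g χ is ¬¬-stable in ⊢F.
module Submission where

open import Defs
open import Function.Bundles using (_⇔_; mk⇔)
open import Data.Product using (proj₁; _,_)
open import Relation.Binary.PropositionalEquality using (_≡_; refl; subst)

module _ {A : Set} where

  ∋-last : ∀ {s : Seq {A}} {χ} → last s ≡ fm χ → s ∋ χ
  ∋-last {start φ} refl = here₀
  ∋-last {s ▷ e}   refl = here

  first⊢O-entry : ∀ {s : Seq {A}} → IsProof s → ∀ {χ} → s ∋ χ → first s ⊢O χ
  first⊢O-entry p-start here₀ = refl⊢
  first⊢O-entry (p-sub P _) (there m) = first⊢O-entry P m
  first⊢O-entry (p-∧I P a b) here = ∧I (first⊢O-entry P a) (first⊢O-entry P b)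
  first⊢O-entry (p-∧I P _ _) (there m) = first⊢O-entry P m
  first⊢O-entry (p-∧E₁ P a) here = trans⊢ (first⊢O-entry P a) ∧E₁
  first⊢O-entry (p-∧E₁ P _) (there m) = first⊢O-entry P m
  first⊢O-entry (p-∧E₂ P a) here = trans⊢ (first⊢O-entry P a) ∧E₂
  first⊢O-entry (p-∧E₂ P _) (there m) = first⊢O-entry P m
  first⊢O-entry (p-∨I₁ P a) here = trans⊢ (first⊢O-entry P a) ∨I₁
  first⊢O-entry (p-∨I₁ P _) (there m) = first⊢O-entry P m
  first⊢O-entry (p-∨I₂ P a) here = trans⊢ (first⊢O-entry P a) ∨I₂
  first⊢O-entry (p-∨I₂ P _) (there m) = first⊢O-entry P m
  first⊢O-entry (p-∨E P@(p-sub (p-sub _ Q₁) Q₂) a (f₁ , l₁) (f₂ , l₂)) here =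
    trans⊢ (first⊢O-entry P a)
           (∨E (subst (_⊢O _) f₁ (first⊢O-entry Q₁ (∋-last l₁)))
               (subst (_⊢O _) f₂ (first⊢O-entry Q₂ (∋-last l₂))))
  first⊢O-entry (p-∨E P _ _ _) (there m) = first⊢O-entry P m
  first⊢O-entry (p-¬I P@(p-sub _ Q) a (f , l)) here =
    trans⊢ (first⊢O-entry P a)
           (trans⊢ ¬¬I (contra (subst (_⊢O _) f (first⊢O-entry Q (∋-last l)))))
  first⊢O-entry (p-¬I P _ _) (there m) = first⊢O-entry P m
  first⊢O-entry (p-¬E P a b) here = trans⊢ (∧I (first⊢O-entry P a) (first⊢O-entry P b)) expl
  first⊢O-entry (p-¬E P _ _) (there m) = first⊢O-entry P m

  ⊢F⇒⊢O : ∀ {φ ψ : Fm A} → φ ⊢F ψ → φ ⊢O ψ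
  ⊢F⇒⊢O (_ , P , f , l) = subst (_⊢O _) f (first⊢O-entry P (∋-last l))

  ⊢O-g : ∀ (φ : Fm A) → φ ⊢O g φ
  g-⊢O : ∀ (φ : Fm A) → g φ ⊢O φ
  ⊢O-g (var p) = ¬¬I
  ⊢O-g (¬ φ)   = contra (g-⊢O φ)
  ⊢O-g (φ ∧ ψ) = ∧I (trans⊢ ∧E₁ (⊢O-g φ)) (trans⊢ ∧E₂ (⊢O-g ψ))
  ⊢O-g (φ ∨ ψ) = ∨E (trans⊢ (⊢O-g φ) (trans⊢ ¬¬I (contra ∧E₁)))
                    (trans⊢ (⊢O-g ψ) (trans⊢ ¬¬I (contra ∧E₂)))
  g-⊢O (var p) = ¬¬E
  g-⊢O (¬ φ)   = contra (⊢O-g φ)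
  g-⊢O (φ ∧ ψ) = ∧I (trans⊢ ∧E₁ (g-⊢O φ)) (trans⊢ ∧E₂ (g-⊢O ψ))
  g-⊢O (φ ∨ ψ) = trans⊢ (contra (∧I (trans⊢ (contra ∨I₁) (contra (g-⊢O φ)))
                                    (trans⊢ (contra ∨I₂) (contra (g-⊢O ψ)))))
                        ¬¬E

  -- A Fitch proof can only open a subproof under ∨E or ¬I, so a derivation
  -- of ψ ⊢F χ is reused after an entry ψ by introducing ψ ∨ ψ and taking it
  -- as both cases of an ∨E.
  splice : ∀ {ψ χ : Fm A} → Seq → ψ ⊢F χ → Seq
  splice {ψ} {χ} s d = s ▷ fm (ψ ∨ ψ) ▷ sub (proj₁ d) ▷ sub (proj₁ d) ▷ fm χ

  IsProof-splice : ∀ {s} {ψ χ : Fm A} → IsProof s → s ∋ ψ → (d : ψ ⊢F χ) →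
                   IsProof (splice s d)
  IsProof-splice P m (_ , Q , be) =
    p-∨E (p-sub (p-sub (p-∨I₁ P m) Q) Q) (there (there here)) be be

  ∋-splice : ∀ {s φ} {ψ χ : Fm A} (d : ψ ⊢F χ) → s ∋ φ → splice s d ∋ φ
  ∋-splice _ m = there (there (there (there m)))

  ⊢F-refl : ∀ {φ : Fm A} → φ ⊢F φ
  ⊢F-refl {φ} = start φ , p-start , refl , refl

  ⊢F-trans : ∀ {φ ψ χ : Fm A} → φ ⊢F ψ → ψ ⊢F χ → φ ⊢F χ
  ⊢F-trans (s , P , f , l) d = splice s d , IsProof-splice P (∋-last l) d , f , refl

  ⊢F-∧I : ∀ {φ ψ χ : Fm A} → φ ⊢F ψ → φ ⊢F χ → φ ⊢F ψ ∧ χ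
  ⊢F-∧I {φ} {ψ} {χ} d e =
    splice (splice (start φ) d) e ▷ fm (ψ ∧ χ) ,
    p-∧I (IsProof-splice (IsProof-splice p-start here₀ d) (∋-splice d here₀) e)
         (∋-splice e here) here ,
    refl , refl

  ⊢F-∧E₁ : ∀ {φ ψ : Fm A} → φ ∧ ψ ⊢F φ
  ⊢F-∧E₁ {φ} {ψ} = start (φ ∧ ψ) ▷ fm φ , p-∧E₁ p-start here₀ , refl , refl

  ⊢F-∧E₂ : ∀ {φ ψ : Fm A} → φ ∧ ψ ⊢F ψ
  ⊢F-∧E₂ {φ} {ψ} = start (φ ∧ ψ) ▷ fm ψ , p-∧E₂ p-start here₀ , refl , refl

  ⊢F-¬¬I : ∀ {φ : Fm A} → φ ⊢F ¬ ¬ φ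
  ⊢F-¬¬I {φ} = start φ ▷ sub (start (¬ φ)) ▷ fm (¬ ¬ φ) ,
               p-¬I (p-sub p-start p-start) (there here₀) (refl , refl) , refl , refl

  ⊢F-expl : ∀ {φ ψ : Fm A} → φ ∧ ¬ φ ⊢F ψ
  ⊢F-expl {φ} {ψ} = start (φ ∧ ¬ φ) ▷ fm φ ▷ fm (¬ φ) ▷ fm ψ ,
    p-¬E (p-∧E₂ (p-∧E₁ p-start here₀) (there here₀)) (there here) here , refl , refl

  ⊢F-¬I : ∀ {φ ψ : Fm A} → φ ⊢F ¬ ¬ ψ → ¬ ψ ⊢F ¬ φ
  ⊢F-¬I {φ} {ψ} (τ , P , be) = start (¬ ψ) ▷ sub τ ▷ fm (¬ φ) ,
    p-¬I (p-sub p-start P) (there here₀) be , refl , refl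

  ⊢F-contra : ∀ {φ ψ : Fm A} → φ ⊢F ψ → ¬ ψ ⊢F ¬ φ
  ⊢F-contra d = ⊢F-¬I (⊢F-trans d ⊢F-¬¬I)

  ¬¬¬⊢F¬ : ∀ {φ : Fm A} → ¬ ¬ ¬ φ ⊢F ¬ φ
  ¬¬¬⊢F¬ = ⊢F-contra ⊢F-¬¬I

  ¬¬g⊢Fg : ∀ (χ : Fm A) → ¬ ¬ g χ ⊢F g χ
  ¬¬g⊢Fg (var p) = ¬¬¬⊢F¬
  ¬¬g⊢Fg (¬ χ)   = ¬¬¬⊢F¬
  ¬¬g⊢Fg (χ ∧ ξ) = ⊢F-∧I (⊢F-trans (⊢F-contra (⊢F-contra ⊢F-∧E₁)) (¬¬g⊢Fg χ))
                         (⊢F-trans (⊢F-contra (⊢F-contra ⊢F-∧E₂)) (¬¬g⊢Fg ξ))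
  ¬¬g⊢Fg (χ ∨ ξ) = ¬¬¬⊢F¬

  ⊢O⇒g⊢Fg : ∀ {φ ψ : Fm A} → φ ⊢O ψ → g φ ⊢F g ψ
  ⊢O⇒g⊢Fg refl⊢        = ⊢F-refl
  ⊢O⇒g⊢Fg ∧E₁          = ⊢F-∧E₁
  ⊢O⇒g⊢Fg ∧E₂          = ⊢F-∧E₂
  ⊢O⇒g⊢Fg ∨I₁          = ⊢F-trans ⊢F-¬¬I (⊢F-contra ⊢F-∧E₁)
  ⊢O⇒g⊢Fg ∨I₂          = ⊢F-trans ⊢F-¬¬I (⊢F-contra ⊢F-∧E₂)
  ⊢O⇒g⊢Fg ¬¬I          = ⊢F-¬¬I
  ⊢O⇒g⊢Fg expl         = ⊢F-expl
  ⊢O⇒g⊢Fg (trans⊢ d e) = ⊢F-trans (⊢O⇒g⊢Fg d) (⊢O⇒g⊢Fg e)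
  ⊢O⇒g⊢Fg (∧I d e)     = ⊢F-∧I (⊢O⇒g⊢Fg d) (⊢O⇒g⊢Fg e)
  ⊢O⇒g⊢Fg (∨E {χ = χ} d e) =
    ⊢F-trans (⊢F-contra (⊢F-∧I (⊢F-contra (⊢O⇒g⊢Fg d)) (⊢F-contra (⊢O⇒g⊢Fg e))))
             (¬¬g⊢Fg χ)
  ⊢O⇒g⊢Fg (contra d)   = ⊢F-contra (⊢O⇒g⊢Fg d)
  ⊢O⇒g⊢Fg (¬¬E {φ})    = ¬¬g⊢Fg φ

proposition2p3 : {A : Set} → A → (φ ψ : Fm A) → (φ ⊢O ψ) ⇔ (g φ ⊢F g ψ)
proposition2p3 _ φ ψ =
  mk⇔ ⊢O⇒g⊢Fg (λ d → trans⊢ (⊢O-g φ) (trans⊢ (⊢F⇒⊢O d) (g-⊢O ψ)))
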